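{- Let $v>4$ be an integer with $q_0(v)<0$. Then $R_0\le\alpha v$, where $\alpha=1-\sqrt2/2$.
   Context: $m=\frac12\binom v2$; $k_0$ is the integer with $\binom{k_0}2\le m<\binom{k_0+1}2$; $e_0=\binom{k_0}2$; $q_0(v)=\frac14\left(1-2(2k_0-3)^2+(2v-5)^2\right)$; $R_0=\frac{8(m-e_0)(k_0-2)}{ -1-2(2k_0-4)^2+(2v-5)^2}$. -}

module Defs where

open import Data.Nat as ℕ using (ℕ)
open import Data.Nat.Combinatorics using (_C_)
open import Data.Integer as ℤ using (ℤ; +_)
open import Data.Rational as ℚ using (ℚ; 0ℚ; 1ℚ; _+_; _-_; _*_; _÷_; _≤_; _<_; ≢-nonZero)
open import Data.Rational.Properties using (_≟_)
open import Data.Product using (_×_)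
open import Relation.Nullary using (yes; no)

⟦_⟧ : ℕ → ℚ
⟦ n ⟧ = (+ n) ℚ./ 1

⟦_⟧ᶻ : ℤ → ℚ
⟦ z ⟧ᶻ = z ℚ./ 1

-- total division on ℚ (returns 0 for a zero denominator; never used in that
-- case under the hypotheses of lemma15, where the denominator is positive)
_⊘_ : ℚ → ℚ → ℚ
p ⊘ q with q ≟ 0ℚ
... | yes _  = 0ℚ
... | no q≢0 = _÷_ p q {{≢-nonZero q≢0}}

m : ℕ → ℚ
m v = ⟦ v C 2 ⟧ ⊘ ⟦ 2 ⟧

IsK0 : ℕ → ℕ → Set
IsK0 v k0 = (⟦ k0 C 2 ⟧ ≤ m v) × (m v < ⟦ ℕ.suc k0 C 2 ⟧)

e0 : ℕ → ℚ
e0 k0 = ⟦ k0 C 2 ⟧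

sq : ℚ → ℚ
sq x = x * x

q0 : ℕ → ℕ → ℚ
q0 v k0 = (1ℚ - ⟦ 2 ⟧ * sq (⟦ 2 ⟧ * ⟦ k0 ⟧ - ⟦ 3 ⟧) + sq (⟦ 2 ⟧ * ⟦ v ⟧ - ⟦ 5 ⟧)) ⊘ ⟦ 4 ⟧

R0 : ℕ → ℕ → ℚ
R0 v k0 = (⟦ 8 ⟧ * (m v - e0 k0) * (⟦ k0 ⟧ - ⟦ 2 ⟧))
          ⊘ (ℚ.- 1ℚ - ⟦ 2 ⟧ * sq (⟦ 2 ⟧ * ⟦ k0 ⟧ - ⟦ 4 ⟧) + sq (⟦ 2 ⟧ * ⟦ v ⟧ - ⟦ 5 ⟧))

-- x ≤ α·v with α = 1 - √2/2, for v ≥ 0 a natural number.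
-- Since √2/2·v ≥ 0:  x ≤ v - (√2/2)v  ⇔  0 ≤ v - x  and  v²/2 ≤ (v - x)².
≤αv : ℚ → ℕ → Set
≤αv x v = (0ℚ ≤ ⟦ v ⟧ - x) × (sq ⟦ v ⟧ ≤ ⟦ 2 ⟧ * sq (⟦ v ⟧ - x))

module Submission where

-- Write k = k0.  Every quantity in the statement is the rational value of an integer
-- polynomial in (v, k):  with
--   excess = v² - v - 2(k² - k) = 4(m - e0),   gap = 2k² - 6k - v² + 5v - 2 = -q0,
--   slack = 3k - 2v - 1,   root = 2k + 1,   bound = 2v - root,
-- the numerator of R0 is 2·excess·(k - 2) and its denominator is D = 4·excess + 8·slack.
-- The hypotheses give excess ≥ 0 (from e0 ≤ m) and gap ≥ 1 (from q0 < 0, by integrality);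
-- for v ≥ 5 integrality also forces slack ≥ 0.  Polynomial identities then show, over ℤ,
--   D ≥ 0,   bound·D = 2·numerator + 4·slack·gap,
--   6(root² - 2v²) = 12·gap + 32·slack + 4(v - 5) + 82,
-- so 2·R0 ≤ 2v - root with root ≥ √2·v, which is R0 ≤ (1 - √2/2)·v  (if D = 0 then R0 = 0
-- by the convention for division by zero, and the bound is immediate).

open import Defs
open import Data.Nat as ℕ using (ℕ; zero; suc; z≤n; s≤s)
open import Data.Nat.Combinatorics using (_C_; nCk+nC[k+1]≡[n+1]C[k+1]; nC1≡n)
open import Data.Nat.Coprimality using (1-coprimeTo) renaming (sym to coprime-sym)
open import Data.Nat.Tactic.RingSolver using () renaming (solve-∀ to ℕ-solve)
open import Data.Fin using () renaming (zero to #0; suc to #suc)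
open import Data.Vec using (_∷_; [])
open import Data.Integer as ℤ using (ℤ; +_; 0ℤ; +≤+)
import Data.Integer.Properties as ℤP
open import Data.Integer.Solver using (module +-*-Solver)
open +-*-Solver
  using (Polynomial; op; [+]; [*]; con; var; _:^_; :-_; _:+_; _:*_; _:-_; solve; _:=_)
  renaming (⟦_⟧ to evalℤ)
open import Data.Rational as ℚ using (ℚ; mkℚ; 0ℚ; 1ℚ; _+_; _*_; _-_; -_; _≤_; _<_)
import Data.Rational.Properties as ℚP
open import Data.Rational.Solver using () renaming (module +-*-Solver to ℚ-Solver)
open import Data.Product using (_,_)
open import Data.Sum using (_⊎_; inj₁; inj₂)
open import Relation.Nullary using (yes; no; contradiction)
open import Relation.Binary.PropositionalEquality

open ℚ-Solver using ()
  renaming (solve to solveℚ; con to κ; _:+_ to _⊕_; _:*_ to _⊛_; _:-_ to _⊖_; _:=_ to _⊜_)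

integral : ℤ → ℚ
integral z = mkℚ z 0 (coprime-sym (1-coprimeTo _))

embed-mkℚ : ∀ z → ⟦ z ⟧ᶻ ≡ integral z
embed-mkℚ z = ℚP.↥p/↧p≡p (integral z)

embed-+ : ∀ a b → ⟦ a ℤ.+ b ⟧ᶻ ≡ ⟦ a ⟧ᶻ + ⟦ b ⟧ᶻ
embed-+ a b = sym (trans (cong₂ _+_ (embed-mkℚ a) (embed-mkℚ b))
  (cong (ℚ._/ 1) (cong₂ ℤ._+_ (ℤP.*-identityʳ a) (ℤP.*-identityʳ b))))

embed-* : ∀ a b → ⟦ a ℤ.* b ⟧ᶻ ≡ ⟦ a ⟧ᶻ * ⟦ b ⟧ᶻ
embed-* a b = sym (cong₂ _*_ (embed-mkℚ a) (embed-mkℚ b))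

embed-neg : ∀ a → ⟦ ℤ.- a ⟧ᶻ ≡ - ⟦ a ⟧ᶻ
embed-neg a = trans (embed-mkℚ (ℤ.- a)) (trans (neg-mkℚ a) (cong -_ (sym (embed-mkℚ a))))
  where
  neg-mkℚ : ∀ a → integral (ℤ.- a) ≡ - integral a
  neg-mkℚ (+ zero)    = refl
  neg-mkℚ ℤ.+[1+ n ] = refl
  neg-mkℚ ℤ.-[1+ n ] = refl

embed-mono-≤ : ∀ {a b} → a ℤ.≤ b → ⟦ a ⟧ᶻ ≤ ⟦ b ⟧ᶻ
embed-mono-≤ {a} {b} a≤b = subst₂ _≤_ (sym (embed-mkℚ a)) (sym (embed-mkℚ b))
  (ℚ.*≤* (subst₂ ℤ._≤_ (sym (ℤP.*-identityʳ a)) (sym (ℤP.*-identityʳ b)) a≤b))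

embed-cancel-≤ : ∀ {a b} → ⟦ a ⟧ᶻ ≤ ⟦ b ⟧ᶻ → a ℤ.≤ b
embed-cancel-≤ {a} {b} a≤b = subst₂ ℤ._≤_ (ℤP.*-identityʳ a) (ℤP.*-identityʳ b)
  (ℚP.drop-*≤* (subst₂ _≤_ (embed-mkℚ a) (embed-mkℚ b) a≤b))

embed-cancel-< : ∀ {a b} → ⟦ a ⟧ᶻ < ⟦ b ⟧ᶻ → a ℤ.< b
embed-cancel-< {a} {b} a<b = subst₂ ℤ._<_ (ℤP.*-identityʳ a) (ℤP.*-identityʳ b)
  (ℚP.drop-*<* (subst₂ _<_ (embed-mkℚ a) (embed-mkℚ b) a<b))

Poly : Set
Poly = Polynomial 2

𝕧 𝕜 : Poly
𝕧 = var #0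
𝕜 = var (#suc #0)

c : ℕ → Poly
c n = con (+ n)

sqP : Poly → Poly
sqP p = p :* p

infix 30 _⟨_,_⟩ _⟪_,_⟫

_⟨_,_⟩ : Poly → ℤ → ℤ → ℤ
p ⟨ v , k ⟩ = evalℤ p (v ∷ k ∷ [])

powℚ : ℚ → ℕ → ℚ
powℚ x zero    = 1ℚ
powℚ x (suc n) = x * powℚ x n

_⟪_,_⟫ : Poly → ℚ → ℚ → ℚ
op [+] p q       ⟪ V , K ⟫ = p ⟪ V , K ⟫ + q ⟪ V , K ⟫
op [*] p q       ⟪ V , K ⟫ = p ⟪ V , K ⟫ * q ⟪ V , K ⟫
con z            ⟪ V , K ⟫ = ⟦ z ⟧ᶻ
var #0           ⟪ V , K ⟫ = V
var (#suc #0)    ⟪ V , K ⟫ = K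
(p :^ n)         ⟪ V , K ⟫ = powℚ (p ⟪ V , K ⟫) n
(:- p)           ⟪ V , K ⟫ = - p ⟪ V , K ⟫

eval-embed : ∀ p v k → ⟦ p ⟨ v , k ⟩ ⟧ᶻ ≡ p ⟪ ⟦ v ⟧ᶻ , ⟦ k ⟧ᶻ ⟫
eval-embed (op [+] p q)    v k = trans (embed-+ (p ⟨ v , k ⟩) (q ⟨ v , k ⟩))
                                        (cong₂ _+_ (eval-embed p v k) (eval-embed q v k))
eval-embed (op [*] p q)    v k = trans (embed-* (p ⟨ v , k ⟩) (q ⟨ v , k ⟩))
                                        (cong₂ _*_ (eval-embed p v k) (eval-embed q v k))
eval-embed (con z)         v k = refl
eval-embed (var #0)        v k = refl
eval-embed (var (#suc #0)) v k = refl
eval-embed (p :^ zero)     v k = refl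
eval-embed (p :^ suc n)    v k = trans (embed-* (p ⟨ v , k ⟩) ((p :^ n) ⟨ v , k ⟩))
                                        (cong₂ _*_ (eval-embed p v k) (eval-embed (p :^ n) v k))
eval-embed (:- p)          v k = trans (embed-neg (p ⟨ v , k ⟩)) (cong -_ (eval-embed p v k))

poly-mono-≤ : ∀ p q v k → p ⟨ v , k ⟩ ℤ.≤ q ⟨ v , k ⟩ →
              p ⟪ ⟦ v ⟧ᶻ , ⟦ k ⟧ᶻ ⟫ ≤ q ⟪ ⟦ v ⟧ᶻ , ⟦ k ⟧ᶻ ⟫
poly-mono-≤ p q v k p≤q = subst₂ _≤_ (eval-embed p v k) (eval-embed q v k) (embed-mono-≤ p≤q)

poly-cancel-≤ : ∀ p q v k → p ⟪ ⟦ v ⟧ᶻ , ⟦ k ⟧ᶻ ⟫ ≤ q ⟪ ⟦ v ⟧ᶻ , ⟦ k ⟧ᶻ ⟫ →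
                p ⟨ v , k ⟩ ℤ.≤ q ⟨ v , k ⟩
poly-cancel-≤ p q v k p≤q =
  embed-cancel-≤ (subst₂ _≤_ (sym (eval-embed p v k)) (sym (eval-embed q v k)) p≤q)

poly-cancel-< : ∀ p q v k → p ⟪ ⟦ v ⟧ᶻ , ⟦ k ⟧ᶻ ⟫ < q ⟪ ⟦ v ⟧ᶻ , ⟦ k ⟧ᶻ ⟫ →
                p ⟨ v , k ⟩ ℤ.< q ⟨ v , k ⟩
poly-cancel-< p q v k p<q =
  embed-cancel-< (subst₂ _<_ (sym (eval-embed p v k)) (sym (eval-embed q v k)) p<q)

-- The polynomials of the problem: qP = 4·q0, and numerP / denomP = R0 (see R0-quotient);
-- the others are the auxiliary quantities of the argument.
qP denomP excessP numerP gapP slackP rootP boundP : Poly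
qP      = c 1 :- c 2 :* sqP (c 2 :* 𝕜 :- c 3) :+ sqP (c 2 :* 𝕧 :- c 5)
denomP  = :- c 1 :- c 2 :* sqP (c 2 :* 𝕜 :- c 4) :+ sqP (c 2 :* 𝕧 :- c 5)
excessP = (sqP 𝕧 :- 𝕧) :- c 2 :* (sqP 𝕜 :- 𝕜)
numerP  = c 2 :* excessP :* (𝕜 :- c 2)
gapP    = c 2 :* sqP 𝕜 :- c 6 :* 𝕜 :- sqP 𝕧 :+ c 5 :* 𝕧 :- c 2
slackP  = c 3 :* 𝕜 :- c 2 :* 𝕧 :- c 1
rootP   = c 2 :* 𝕜 :+ c 1
boundP  = c 2 :* 𝕧 :- rootP

-- The polynomial identities behind the argument, checked by the ring solver.  (The
-- polynomials above already mention the solver's variables, so the bound names are unused.)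

gap-identity : ∀ v k → + 4 ℤ.* gapP ⟨ v , k ⟩ ≡ ℤ.- qP ⟨ v , k ⟩
gap-identity = solve 2 (λ _ _ → c 4 :* gapP := :- qP) refl

-- If slack < 0 then deficit = -(1 + slack) ≥ 0, so for v ≥ 5 the remainder below is ≥ 0
-- and the certificate bounds gap by 2/9.
deficitP remainderP : Poly
deficitP   = c 0 :- (c 1 :+ slackP)
remainderP = (𝕧 :- c 4) :* (𝕧 :- c 5) :+ c 2 :* deficitP :* (c 2 :* (𝕧 :- c 5) :+ c 3 :* 𝕜 :+ c 1)

slack-certificate : ∀ v k → + 9 ℤ.* gapP ⟨ v , k ⟩ ℤ.+ remainderP ⟨ v , k ⟩ ≡ + 2
slack-certificate = solve 2 (λ _ _ → c 9 :* gapP :+ remainderP := c 2) refl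

denom-identity : ∀ v k → denomP ⟨ v , k ⟩ ≡ (c 4 :* excessP :+ c 8 :* slackP) ⟨ v , k ⟩
denom-identity = solve 2 (λ _ _ → denomP := c 4 :* excessP :+ c 8 :* slackP) refl

numer-identity : ∀ v k → (boundP :* denomP) ⟨ v , k ⟩
                        ≡ (c 2 :* numerP) ⟨ v , k ⟩ ℤ.+ (c 4 :* slackP :* gapP) ⟨ v , k ⟩
numer-identity = solve 2 (λ _ _ → boundP :* denomP := c 2 :* numerP :+ c 4 :* slackP :* gapP) refl

root-identity : ∀ v k → + 6 ℤ.* (sqP rootP :- c 2 :* sqP 𝕧) ⟨ v , k ⟩
                       ≡ (c 12 :* gapP :+ c 32 :* slackP :+ c 4 :* (𝕧 :- c 5) :+ c 82) ⟨ v , k ⟩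
root-identity = solve 2 (λ _ _ → c 6 :* (sqP rootP :- c 2 :* sqP 𝕧)
                                 := c 12 :* gapP :+ c 32 :* slackP :+ c 4 :* (𝕧 :- c 5) :+ c 82) refl

double-identity : ∀ v k → sqP (c 2 :* 𝕧) ⟨ v , k ⟩
                         ≡ (c 2 :* sqP 𝕧) ⟨ v , k ⟩ ℤ.+ (c 2 :* sqP 𝕧) ⟨ v , k ⟩
double-identity = solve 2 (λ _ _ → sqP (c 2 :* 𝕧) := c 2 :* sqP 𝕧 :+ c 2 :* sqP 𝕧) refl

0≤+ : ∀ {a b} → 0ℤ ℤ.≤ a → 0ℤ ℤ.≤ b → 0ℤ ℤ.≤ a ℤ.+ b
0≤+ = ℤP.+-mono-≤

0≤* : ∀ {a b} → 0ℤ ℤ.≤ a → 0ℤ ℤ.≤ b → 0ℤ ℤ.≤ a ℤ.* b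
0≤* {+ m} {+ n} _ _ = subst (0ℤ ℤ.≤_) (ℤP.pos-* m n) (+≤+ z≤n)

0≤ℕ : ∀ n → 0ℤ ℤ.≤ + n
0≤ℕ n = +≤+ z≤n

≤-+-nonneg : ∀ {a b} → 0ℤ ℤ.≤ b → a ℤ.≤ a ℤ.+ b
≤-+-nonneg {a} {b} 0≤b = ℤP.i≤i+j a b {{ℤ.nonNegative 0≤b}}

gap-positive : ∀ v k → qP ⟨ v , k ⟩ ℤ.< 0ℤ → + 1 ℤ.≤ gapP ⟨ v , k ⟩
gap-positive v k q<0 = ℤP.i<j⇒suc[i]≤j (ℤP.*-cancelˡ-<-nonNeg {0ℤ} (+ 4)
  (subst (0ℤ ℤ.<_) (sym (gap-identity v k)) (ℤP.neg-mono-< q<0)))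

-- For v ≥ 5 and gap ≥ 1, slack ≥ 0: otherwise deficit ≥ 0 and the certificate gives 9 ≤ 2.
slack-nonneg : ∀ v k → + 5 ℤ.≤ v → 0ℤ ℤ.≤ k → + 1 ℤ.≤ gapP ⟨ v , k ⟩ →
               0ℤ ℤ.≤ slackP ⟨ v , k ⟩
slack-nonneg v k 5≤v 0≤k 1≤gap with 0ℤ ℤP.≤? slackP ⟨ v , k ⟩
... | yes 0≤slack = 0≤slack
... | no  slack≱0 = contradiction 9≤2 λ { (+≤+ (s≤s (s≤s ()))) }
  where
  deficit≥0 : 0ℤ ℤ.≤ deficitP ⟨ v , k ⟩
  deficit≥0 = ℤP.i≤j⇒0≤j-i (ℤP.i<j⇒suc[i]≤j (ℤP.≰⇒> slack≱0))
  v-5≥0 : 0ℤ ℤ.≤ (𝕧 :- c 5) ⟨ v , k ⟩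
  v-5≥0 = ℤP.i≤j⇒0≤j-i 5≤v
  v-4≥0 : 0ℤ ℤ.≤ (𝕧 :- c 4) ⟨ v , k ⟩
  v-4≥0 = ℤP.i≤j⇒0≤j-i (ℤP.≤-trans (ℤP.i≤suc[i] (+ 4)) 5≤v)
  remainder≥0 : 0ℤ ℤ.≤ remainderP ⟨ v , k ⟩
  remainder≥0 = 0≤+ (0≤* v-4≥0 v-5≥0) (0≤* (0≤* (0≤ℕ 2) deficit≥0)
                  (0≤+ (0≤+ (0≤* (0≤ℕ 2) v-5≥0) (0≤* (0≤ℕ 3) 0≤k)) (0≤ℕ 1)))
  9≤2 : + 9 ℤ.≤ + 2
  9≤2 = ℤP.≤-trans (ℤP.*-monoˡ-≤-nonNeg (+ 9) 1≤gap)
          (subst (+ 9 ℤ.* gapP ⟨ v , k ⟩ ℤ.≤_) (slack-certificate v k) (≤-+-nonneg remainder≥0))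

denom-nonneg : ∀ v k → 0ℤ ℤ.≤ excessP ⟨ v , k ⟩ → 0ℤ ℤ.≤ slackP ⟨ v , k ⟩ →
               0ℤ ℤ.≤ denomP ⟨ v , k ⟩
denom-nonneg v k 0≤excess 0≤slack = subst (0ℤ ℤ.≤_) (sym (denom-identity v k))
  (0≤+ (0≤* (0≤ℕ 4) 0≤excess) (0≤* (0≤ℕ 8) 0≤slack))

numer-bound : ∀ v k → 0ℤ ℤ.≤ slackP ⟨ v , k ⟩ → 0ℤ ℤ.≤ gapP ⟨ v , k ⟩ →
              (c 2 :* numerP) ⟨ v , k ⟩ ℤ.≤ (boundP :* denomP) ⟨ v , k ⟩
numer-bound v k 0≤slack 0≤gap =
  subst ((c 2 :* numerP) ⟨ v , k ⟩ ℤ.≤_) (sym (numer-identity v k))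
        (≤-+-nonneg (0≤* (0≤* (0≤ℕ 4) 0≤slack) 0≤gap))

-- root = 2k + 1 is at least √2·v, since 6·(root² - 2v²) is a nonnegative combination.
root-bound : ∀ v k → + 5 ℤ.≤ v → 0ℤ ℤ.≤ slackP ⟨ v , k ⟩ → 0ℤ ℤ.≤ gapP ⟨ v , k ⟩ →
             (c 2 :* sqP 𝕧) ⟨ v , k ⟩ ℤ.≤ sqP rootP ⟨ v , k ⟩
root-bound v k 5≤v 0≤slack 0≤gap =
  ℤP.0≤i-j⇒j≤i (ℤP.*-cancelˡ-≤-pos 0ℤ ((sqP rootP :- c 2 :* sqP 𝕧) ⟨ v , k ⟩) (+ 6)
    (subst (0ℤ ℤ.≤_) (sym (root-identity v k)) combination≥0))
  where
  combination≥0 : 0ℤ ℤ.≤ (c 12 :* gapP :+ c 32 :* slackP :+ c 4 :* (𝕧 :- c 5) :+ c 82) ⟨ v , k ⟩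
  combination≥0 = 0≤+ (0≤+ (0≤+ (0≤* (0≤ℕ 12) 0≤gap) (0≤* (0≤ℕ 32) 0≤slack))
                           (0≤* (0≤ℕ 4) (ℤP.i≤j⇒0≤j-i 5≤v)))
                      (0≤ℕ 82)

double-choose-2 : ∀ n → 2 ℕ.* (n C 2) ℕ.+ n ≡ n ℕ.* n
double-choose-2 zero    = refl
double-choose-2 (suc n) = begin
  2 ℕ.* (suc n C 2) ℕ.+ suc n             ≡⟨ cong (λ b → 2 ℕ.* b ℕ.+ suc n) pascal ⟨
  2 ℕ.* (n ℕ.+ n C 2) ℕ.+ suc n           ≡⟨ regroup (n C 2) n ⟩
  (2 ℕ.* (n C 2) ℕ.+ n) ℕ.+ (2 ℕ.* n ℕ.+ 1) ≡⟨ cong (ℕ._+ (2 ℕ.* n ℕ.+ 1)) (double-choose-2 n) ⟩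
  n ℕ.* n ℕ.+ (2 ℕ.* n ℕ.+ 1)             ≡⟨ square-suc n ⟩
  suc n ℕ.* suc n                         ∎
  where
  open ≡-Reasoning
  pascal : n ℕ.+ n C 2 ≡ suc n C 2
  pascal = trans (cong (ℕ._+ n C 2) (sym (nC1≡n n))) (nCk+nC[k+1]≡[n+1]C[k+1] n 1)
  regroup : ∀ b n → 2 ℕ.* (n ℕ.+ b) ℕ.+ suc n ≡ (2 ℕ.* b ℕ.+ n) ℕ.+ (2 ℕ.* n ℕ.+ 1)
  regroup = ℕ-solve
  square-suc : ∀ n → n ℕ.* n ℕ.+ (2 ℕ.* n ℕ.+ 1) ≡ suc n ℕ.* suc n
  square-suc = ℕ-solve

embedℕ-* : ∀ a b → ⟦ a ℕ.* b ⟧ ≡ ⟦ a ⟧ * ⟦ b ⟧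
embedℕ-* a b = trans (cong ⟦_⟧ᶻ (ℤP.pos-* a b)) (embed-* (+ a) (+ b))

choose-2 : ∀ n → ⟦ 2 ⟧ * ⟦ n C 2 ⟧ ≡ ⟦ n ⟧ * ⟦ n ⟧ - ⟦ n ⟧
choose-2 n = begin
  ⟦ 2 ⟧ * ⟦ n C 2 ⟧                     ≡⟨ add-sub (⟦ 2 ⟧ * ⟦ n C 2 ⟧) ⟦ n ⟧ ⟩
  (⟦ 2 ⟧ * ⟦ n C 2 ⟧ + ⟦ n ⟧) - ⟦ n ⟧    ≡⟨ cong (_- ⟦ n ⟧) sum ⟩
  ⟦ n ⟧ * ⟦ n ⟧ - ⟦ n ⟧                 ∎
  where
  open ≡-Reasoning
  add-sub : ∀ x y → x ≡ (x + y) - y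
  add-sub = solveℚ 2 (λ x y → x ⊜ (x ⊕ y) ⊖ y) refl
  sum : ⟦ 2 ⟧ * ⟦ n C 2 ⟧ + ⟦ n ⟧ ≡ ⟦ n ⟧ * ⟦ n ⟧
  sum = begin
    ⟦ 2 ⟧ * ⟦ n C 2 ⟧ + ⟦ n ⟧    ≡⟨ cong (_+ ⟦ n ⟧) (embedℕ-* 2 (n C 2)) ⟨
    ⟦ 2 ℕ.* (n C 2) ⟧ + ⟦ n ⟧    ≡⟨ embed-+ (+ (2 ℕ.* (n C 2))) (+ n) ⟨
    ⟦ 2 ℕ.* (n C 2) ℕ.+ n ⟧      ≡⟨ cong ⟦_⟧ (double-choose-2 n) ⟩
    ⟦ n ℕ.* n ⟧                  ≡⟨ embedℕ-* n n ⟩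
    ⟦ n ⟧ * ⟦ n ⟧                ∎

four-m-minus-e0 : ∀ v k → ⟦ 4 ⟧ * (m v - e0 k) ≡ excessP ⟪ ⟦ v ⟧ , ⟦ k ⟧ ⟫
four-m-minus-e0 v k = begin
  ⟦ 4 ⟧ * (m v - e0 k)                            ≡⟨ scale ⟦ v C 2 ⟧ ⟦ k C 2 ⟧ ⟩
  ⟦ 2 ⟧ * ⟦ v C 2 ⟧ - ⟦ 2 ⟧ * (⟦ 2 ⟧ * ⟦ k C 2 ⟧) ≡⟨ cong₂ (λ x y → x - ⟦ 2 ⟧ * y)
                                                            (choose-2 v) (choose-2 k) ⟩
  excessP ⟪ ⟦ v ⟧ , ⟦ k ⟧ ⟫                       ∎
  where
  open ≡-Reasoning
  -- m v unfolds to ⟦ C(v,2) ⟧ · (1/2).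
  scale : ∀ x y → ⟦ 4 ⟧ * (x * ℚ.1/ ⟦ 2 ⟧ - y) ≡ ⟦ 2 ⟧ * x - ⟦ 2 ⟧ * (⟦ 2 ⟧ * y)
  scale = solveℚ 2 (λ x y → κ ⟦ 4 ⟧ ⊛ (x ⊛ κ (ℚ.1/ ⟦ 2 ⟧) ⊖ y)
                          ⊜ κ ⟦ 2 ⟧ ⊛ x ⊖ κ ⟦ 2 ⟧ ⊛ (κ ⟦ 2 ⟧ ⊛ y)) refl

R0-quotient : ∀ v k → R0 v k ≡ numerP ⟪ ⟦ v ⟧ , ⟦ k ⟧ ⟫ ⊘ denomP ⟪ ⟦ v ⟧ , ⟦ k ⟧ ⟫
R0-quotient v k = cong (_⊘ denomP ⟪ ⟦ v ⟧ , ⟦ k ⟧ ⟫) (begin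
  ⟦ 8 ⟧ * (m v - e0 k) * (⟦ k ⟧ - ⟦ 2 ⟧)           ≡⟨ regroup (m v - e0 k) (⟦ k ⟧ - ⟦ 2 ⟧) ⟩
  ⟦ 2 ⟧ * (⟦ 4 ⟧ * (m v - e0 k)) * (⟦ k ⟧ - ⟦ 2 ⟧) ≡⟨ cong (λ x → ⟦ 2 ⟧ * x * (⟦ k ⟧ - ⟦ 2 ⟧))
                                                          (four-m-minus-e0 v k) ⟩
  numerP ⟪ ⟦ v ⟧ , ⟦ k ⟧ ⟫                         ∎)
  where
  open ≡-Reasoning
  regroup : ∀ x y → ⟦ 8 ⟧ * x * y ≡ ⟦ 2 ⟧ * (⟦ 4 ⟧ * x) * y
  regroup = solveℚ 2 (λ x y → κ ⟦ 8 ⟧ ⊛ x ⊛ y ⊜ κ ⟦ 2 ⟧ ⊛ (κ ⟦ 4 ⟧ ⊛ x) ⊛ y) refl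

excess-nonneg : ∀ v k → e0 k ≤ m v → 0ℤ ℤ.≤ excessP ⟨ + v , + k ⟩
excess-nonneg v k e0≤m = poly-cancel-≤ (c 0) excessP (+ v) (+ k)
  (subst (0ℚ ≤_) (four-m-minus-e0 v k) (ℚP.*-monoˡ-≤-nonNeg ⟦ 4 ⟧ 0≤m-e0))
  where
  0≤m-e0 : 0ℚ ≤ m v - e0 k
  0≤m-e0 = subst (_≤ m v - e0 k) (ℚP.+-inverseʳ (e0 k)) (ℚP.+-monoˡ-≤ (- e0 k) e0≤m)

-- The hypothesis q0 < 0 says that qP < 0 (q0 unfolds to the value of qP times 1/4).
q-negative : ∀ v k → q0 v k < 0ℚ → qP ⟨ + v , + k ⟩ ℤ.< 0ℤ
q-negative v k q0<0 = poly-cancel-< qP (c 0) (+ v) (+ k) (ℚP.*-cancelʳ-<-nonNeg (ℚ.1/ ⟦ 4 ⟧) q0<0)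

⊘-bound : ∀ a N D B → 0ℚ ≤ D → a * N ≤ B * D → (N ⊘ D ≡ 0ℚ) ⊎ (a * (N ⊘ D) ≤ B)
⊘-bound a N D B 0≤D aN≤BD with D ℚP.≟ 0ℚ
... | yes _   = inj₁ refl
... | no  D≢0 = inj₂ (ℚP.*-cancelʳ-≤-pos D (subst (_≤ B * D) (sym quotient-times-D) aN≤BD))
  where
  instance
    D-nonzero : ℚ.NonZero D
    D-nonzero = ℚ.≢-nonZero D≢0
    D-positive : ℚ.Positive D
    D-positive = ℚP.nonNeg∧nonZero⇒pos D {{ℚ.nonNegative 0≤D}}
  open ≡-Reasoning
  quotient-times-D : a * (N ℚ.÷ D) * D ≡ a * N
  quotient-times-D = begin
    a * (N * ℚ.1/ D) * D      ≡⟨ ℚP.*-assoc a (N * ℚ.1/ D) D ⟩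
    a * (N * ℚ.1/ D * D)      ≡⟨ cong (a *_) (ℚP.*-assoc N (ℚ.1/ D) D) ⟩
    a * (N * (ℚ.1/ D * D))    ≡⟨ cong (λ x → a * (N * x)) (ℚP.*-inverseˡ D) ⟩
    a * (N * 1ℚ)              ≡⟨ cong (a *_) (ℚP.*-identityʳ N) ⟩
    a * N                     ∎

square-mono : ∀ {x y} → 0ℚ ≤ x → x ≤ y → sq x ≤ sq y
square-mono {x} {y} 0≤x x≤y = ℚP.≤-trans
  (ℚP.*-monoˡ-≤-nonNeg x {{ℚ.nonNegative 0≤x}} x≤y)
  (ℚP.*-monoʳ-≤-nonNeg y {{ℚ.nonNegative (ℚP.≤-trans 0≤x x≤y)}} x≤y)

-- The √2-criterion: if a ≥ 0, a² ≥ 2v² and 2x ≤ 2v - a, then v - x ≥ a/2 ≥ v/√2,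
-- that is, x ≤ (1 - √2/2)·v.
≤αv-criterion : ∀ x v a → 0ℚ ≤ a → ⟦ 2 ⟧ * sq ⟦ v ⟧ ≤ sq a →
                ⟦ 2 ⟧ * x ≤ ⟦ 2 ⟧ * ⟦ v ⟧ - a → ≤αv x v
≤αv-criterion x v a 0≤a 2v²≤a² 2x≤2v-a = 0≤v-x , v²≤2[v-x]²
  where
  open ℚP.≤-Reasoning
  V : ℚ
  V = ⟦ v ⟧
  sub-sub : ∀ a y → a ≡ y - (y - a)
  sub-sub = solveℚ 2 (λ a y → a ⊜ y ⊖ (y ⊖ a)) refl
  factor-2 : ∀ V x → ⟦ 2 ⟧ * V - ⟦ 2 ⟧ * x ≡ ⟦ 2 ⟧ * (V - x)
  factor-2 = solveℚ 2 (λ V x → κ ⟦ 2 ⟧ ⊛ V ⊖ κ ⟦ 2 ⟧ ⊛ x ⊜ κ ⟦ 2 ⟧ ⊛ (V ⊖ x)) refl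
  square-double : ∀ b → sq (⟦ 2 ⟧ * b) ≡ ⟦ 2 ⟧ * (⟦ 2 ⟧ * sq b)
  square-double = solveℚ 1 (λ b → (κ ⟦ 2 ⟧ ⊛ b) ⊛ (κ ⟦ 2 ⟧ ⊛ b) ⊜ κ ⟦ 2 ⟧ ⊛ (κ ⟦ 2 ⟧ ⊛ (b ⊛ b))) refl
  a≤2[v-x] : a ≤ ⟦ 2 ⟧ * (V - x)
  a≤2[v-x] = begin
    a                           ≡⟨ sub-sub a (⟦ 2 ⟧ * V) ⟩
    ⟦ 2 ⟧ * V - (⟦ 2 ⟧ * V - a) ≤⟨ ℚP.+-monoʳ-≤ (⟦ 2 ⟧ * V) (ℚP.neg-antimono-≤ 2x≤2v-a) ⟩
    ⟦ 2 ⟧ * V - ⟦ 2 ⟧ * x       ≡⟨ factor-2 V x ⟩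
    ⟦ 2 ⟧ * (V - x)             ∎
  0≤v-x : 0ℚ ≤ V - x
  0≤v-x = ℚP.*-cancelˡ-≤-pos ⟦ 2 ⟧ (ℚP.≤-trans 0≤a a≤2[v-x])
  v²≤2[v-x]² : sq V ≤ ⟦ 2 ⟧ * sq (V - x)
  v²≤2[v-x]² = ℚP.*-cancelˡ-≤-pos ⟦ 2 ⟧ (begin
    ⟦ 2 ⟧ * sq V                 ≤⟨ 2v²≤a² ⟩
    sq a                         ≤⟨ square-mono 0≤a a≤2[v-x] ⟩
    sq (⟦ 2 ⟧ * (V - x))         ≡⟨ square-double (V - x) ⟩
    ⟦ 2 ⟧ * (⟦ 2 ⟧ * sq (V - x)) ∎)

≤αv-zero : ∀ v → ≤αv 0ℚ v
≤αv-zero v = ≤αv-criterion 0ℚ v (⟦ 2 ⟧ * ⟦ v ⟧) 0≤2v 2v²≤[2v]²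
  (ℚP.≤-reflexive (sym (ℚP.+-inverseʳ (⟦ 2 ⟧ * ⟦ v ⟧))))
  where
  0≤2v : 0ℚ ≤ ⟦ 2 ⟧ * ⟦ v ⟧
  0≤2v = poly-mono-≤ (c 0) (c 2 :* 𝕧) (+ v) 0ℤ (0≤* (0≤ℕ 2) (0≤ℕ v))
  2v²≤[2v]² : ⟦ 2 ⟧ * sq ⟦ v ⟧ ≤ sq (⟦ 2 ⟧ * ⟦ v ⟧)
  2v²≤[2v]² = poly-mono-≤ (c 2 :* sqP 𝕧) (sqP (c 2 :* 𝕧)) (+ v) 0ℤ
    (subst ((c 2 :* sqP 𝕧) ⟨ + v , 0ℤ ⟩ ℤ.≤_) (sym (double-identity (+ v) 0ℤ))
      (≤-+-nonneg (0≤* (0≤ℕ 2) (0≤* (0≤ℕ v) (0≤ℕ v)))))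

module AtHypotheses (v k : ℕ) (4<v : 4 ℕ.< v) (e0≤m : e0 k ≤ m v) (q0<0 : q0 v k < 0ℚ) where

  N D B A : ℚ
  N = numerP ⟪ ⟦ v ⟧ , ⟦ k ⟧ ⟫
  D = denomP ⟪ ⟦ v ⟧ , ⟦ k ⟧ ⟫
  B = boundP ⟪ ⟦ v ⟧ , ⟦ k ⟧ ⟫
  A = rootP ⟪ ⟦ v ⟧ , ⟦ k ⟧ ⟫

  private
    gap≥1 : + 1 ℤ.≤ gapP ⟨ + v , + k ⟩
    gap≥1 = gap-positive (+ v) (+ k) (q-negative v k q0<0)
    gap≥0 : 0ℤ ℤ.≤ gapP ⟨ + v , + k ⟩
    gap≥0 = ℤP.≤-trans (0≤ℕ 1) gap≥1
    slack≥0 : 0ℤ ℤ.≤ slackP ⟨ + v , + k ⟩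
    slack≥0 = slack-nonneg (+ v) (+ k) (+≤+ 4<v) (0≤ℕ k) gap≥1

  D≥0 : 0ℚ ≤ D
  D≥0 = poly-mono-≤ (c 0) denomP (+ v) (+ k)
          (denom-nonneg (+ v) (+ k) (excess-nonneg v k e0≤m) slack≥0)

  2N≤BD : ⟦ 2 ⟧ * N ≤ B * D
  2N≤BD = poly-mono-≤ (c 2 :* numerP) (boundP :* denomP) (+ v) (+ k)
            (numer-bound (+ v) (+ k) slack≥0 gap≥0)

  A≥0 : 0ℚ ≤ A
  A≥0 = poly-mono-≤ (c 0) rootP (+ v) (+ k) (0≤+ (0≤* (0≤ℕ 2) (0≤ℕ k)) (0≤ℕ 1))

  2v²≤A² : ⟦ 2 ⟧ * sq ⟦ v ⟧ ≤ sq A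
  2v²≤A² = poly-mono-≤ (c 2 :* sqP 𝕧) (sqP rootP) (+ v) (+ k)
             (root-bound (+ v) (+ k) (+≤+ 4<v) slack≥0 gap≥0)

-- Lemma 15.  R0 = N ⊘ D; dividing 2N ≤ B·D by D gives 2·R0 ≤ 2v - A (unless R0 = 0), and
-- the √2-criterion with witness A concludes.
lemma15 : (v k0 : ℕ) → 4 ℕ.< v → IsK0 v k0 → q0 v k0 ℚ.< 0ℚ → ≤αv (R0 v k0) v
lemma15 v k 4<v (e0≤m , _) q0<0 =
  subst (λ r → ≤αv r v) (sym (R0-quotient v k)) (conclude (⊘-bound ⟦ 2 ⟧ N D B D≥0 2N≤BD))
  where
  open AtHypotheses v k 4<v e0≤m q0<0
  conclude : (N ⊘ D ≡ 0ℚ) ⊎ (⟦ 2 ⟧ * (N ⊘ D) ≤ B) → ≤αv (N ⊘ D) v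
  conclude (inj₁ R0≡0)  = subst (λ r → ≤αv r v) (sym R0≡0) (≤αv-zero v)
  conclude (inj₂ 2R0≤B) = ≤αv-criterion (N ⊘ D) v A A≥0 2v²≤A² 2R0≤B
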